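{- Let $l,n\in\mathbb{N}$, let $a_1,\dots,a_n\in\mathbb{N}\cup\{0\}$, let $u_1,\dots,u_n\in T(l)$, and let $X=\{x_1,\dots,x_n\}$ be a pairwise prime subset of $\mathbb{N}$. Then there exist $z\in\mathbb{N}$, integers $r_1,\dots,r_n\in[0,C(l)]$ and $t_1,\dots,t_n\in\mathbb{N}$ such that $z+r_i=a_i+t_ix_iu_i$ for all $i\in[1,n]$.
   Context: $\mathbb{N}=\{1,2,3,\dots\}$, $\mathbb{P}$ is the set of primes, $[a,b]=\{x\in\mathbb{Z}:a\le x\le b\}$. A set is pairwise prime if any two distinct elements are coprime. For prime $p$, $r(p,l)=\max\{t\in\mathbb{N}\cup\{0\}: p^t\le 2l+1\}$; $T(l)=\{\prod_{p\in\mathbb{P}\cap[2,2l+1]}p^{r_p}: 0\le r_p\le r(p,l)\}$; and $C(l)=(2l+1)^{2l+1}$. -}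

module Defs where

open import Data.Nat using (ℕ; zero; suc; _+_; _*_; _^_; _≤_; _≤?_)
open import Data.Nat.Primality using (Prime; prime?)
open import Data.List using (List; filter; map; applyUpTo)
open import Data.Nat.ListAction using (product)
open import Data.Product using (Σ; _×_)
open import Relation.Nullary using (yes; no)
open import Relation.Binary.PropositionalEquality using (_≡_)

range2 : ℕ → List ℕ
range2 l = applyUpTo (λ k → 2 + k) (2 * l)

primesUpTo : ℕ → List ℕ
primesUpTo l = filter prime? (range2 l)

-- largest t ≤ k with p ^ t ≤ m (0 if none)
rUpTo : ℕ → ℕ → ℕ → ℕ
rUpTo p m zero = zero
rUpTo p m (suc k) with p ^ suc k ≤? m
... | yes _ = suc k
... | no _ = rUpTo p m k

-- r(p,l) = max { t ≥ 0 : p^t ≤ 2l+1 }  (for p ≥ 2 such t are ≤ 2l+1)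
r : ℕ → ℕ → ℕ
r p l = rUpTo p (2 * l + 1) (2 * l + 1)

InT : ℕ → ℕ → Set
InT l u = Σ (ℕ → ℕ) λ e →
  ((p : ℕ) → Prime p → p ≤ 2 * l + 1 → e p ≤ r p l) ×
  (u ≡ product (map (λ p → p ^ e p) (primesUpTo l)))

C : ℕ → ℕ
C l = (2 * l + 1) ^ (2 * l + 1)

-- Let P = ∏_{p prime ≤ 2l+1} p^r(p,l).  Every u ∈ T(l) divides P (its exponents are
-- bounded by r(p,l)), and P ≤ (2l+1)^(2l+1) = C(l), since each factor p^r(p,l) is at
-- most 2l+1 and there are at most 2l+1 primes in [2, 2l+1].
--
-- Given any modulus P ≥ 1 divisible by all uᵢ, write aᵢ = Rᵢ + Qᵢ·P with Rᵢ < P.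
-- By the Chinese remainder theorem for the pairwise coprime xᵢ there is w with
-- w = Qᵢ + (1 + sᵢ)·xᵢ for all i; then z = w·P, rᵢ = Rᵢ, tᵢ = (1 + sᵢ)·(P / uᵢ) work.
module Submission where

open import Defs
open import Data.Nat using (ℕ; _+_; _*_; _≤_; _≥_)
open import Data.Fin using (Fin)
open import Data.Nat.Coprimality using (Coprime)
open import Data.Product using (Σ; _×_)
open import Relation.Nullary using (¬_)
open import Relation.Binary.PropositionalEquality using (_≡_)

open import Data.Nat using (zero; suc; _∸_; _^_; _<_; z≤n; s≤s; NonZero; >-nonZero; >-nonZero⁻¹; _≤?_)
open import Data.Nat.Properties
  using (+-comm; +-cancelˡ-≡; ≤-refl; ≤-trans; <⇒≤; m≤m+n; m≤n+m; *-mono-≤; m∸n+n≡m; m^n≢0; ^-distribˡ-+-*; ^-monoʳ-≤; module ≤-Reasoning)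
open import Data.Nat.Divisibility using (_∣_; divides; ∣-trans; *-pres-∣; ∣1⇒≡1)
open import Function using (_∘_)
open import Data.Nat.DivMod using (_/_; _%_; m≡m%n+[m/n]*n; m%n<n)
open import Data.Nat.Coprimality using (coprime-Bézout; coprime-divisor) renaming (sym to coprime-sym)
open import Data.Nat.GCD using (module Bézout)
open import Data.Nat.Primality using (Prime; prime?; prime⇒nonZero)
open import Data.Nat.ListAction using (product)
open import Data.Nat.ListAction.Properties using (∈⇒∣product; product≢0)
open import Data.List using ([]; _∷_; map; length; tabulate)
open import Data.List.Properties using (length-filter; length-applyUpTo)
open import Data.List.Membership.Propositional.Properties using (∈-tabulate⁺)
open import Data.List.Relation.Unary.All using (All; []; _∷_)
open import Data.List.Relation.Unary.All.Properties using (all-filter; filter⁺; applyUpTo⁺₁; tabulate⁺; map⁺)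
import Data.List.Relation.Unary.All as All
open import Data.Product using (_,_; proj₁; proj₂)
open import Relation.Nullary using (yes; no)
open import Relation.Binary.PropositionalEquality using (refl; sym; cong; cong₂; subst; module ≡-Reasoning)
open import Data.Fin.Properties using () renaming (suc-injective to Fin-suc-injective)
open import Data.Nat.Tactic.RingSolver using (solve-∀)

coprime-product : ∀ {a} ns → All (Coprime a) ns → Coprime a (product ns)
coprime-product []       []         (_ , d∣1)   = ∣1⇒≡1 d∣1
coprime-product (m ∷ ns) (a⊥m ∷ a⊥ns) (d∣a , d∣mns) =
  coprime-product ns a⊥ns (d∣a , coprime-divisor d⊥m d∣mns)
  where
  d⊥m : Coprime _ m
  d⊥m (e∣d , e∣m) = a⊥m (∣-trans e∣d d∣a , e∣m)

-- A multiplicative inverse of M modulo x, written without subtraction: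
-- c·M = 1 + y·x.  Bézout gives either this form or 1 + c·M = y·x; in the latter case
-- c' = x'·c + x (where x = 1 + x') inverts M, as x' + c'·M = x'·(1 + c·M) + x·M.
inverse : ∀ {M x} → Coprime M x → 1 ≤ M → 1 ≤ x → Σ ℕ λ c → Σ ℕ λ y → c * M ≡ 1 + y * x
inverse M⊥x _ _ with coprime-Bézout M⊥x
inverse M⊥x _ _ | Bézout.+- c y eq = c , y , sym eq
inverse {suc M'} {suc x'} M⊥x _ _ | Bézout.-+ c y eq =
  x' * c + suc x' , x' * y + M' , +-cancelˡ-≡ x' _ _ shifted
  where
  open ≡-Reasoning
  expand : ∀ x' c M' → x' + (x' * c + suc x') * suc M' ≡ x' * (1 + c * suc M') + suc x' * suc M'
  expand = solve-∀
  collect : ∀ x' y M' → x' * (y * suc x') + suc x' * suc M' ≡ x' + (1 + (x' * y + M') * suc x')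
  collect = solve-∀
  shifted : x' + (x' * c + suc x') * suc M' ≡ x' + (1 + (x' * y + M') * suc x')
  shifted = begin
    x' + (x' * c + suc x') * suc M'         ≡⟨ expand x' c M' ⟩
    x' * (1 + c * suc M') + suc x' * suc M' ≡⟨ cong (λ v → x' * v + suc x' * suc M') eq ⟩
    x' * (y * suc x') + suc x' * suc M'     ≡⟨ collect x' y M' ⟩
    x' + (1 + (x' * y + M') * suc x')       ∎

-- Two coprime moduli: any residue w₀ mod M can be shifted by a multiple of M to hit any
-- residue q mod x.  With c·M = 1 + y·x take k = c·(q + (x-1)·w₀), since
-- -w₀ ≡ (x-1)·w₀ (mod x).
adjoin-modulus : ∀ {M x} w₀ q → Coprime M x → 1 ≤ M → 1 ≤ x →
                 Σ ℕ λ k → Σ ℕ λ s → w₀ + k * M ≡ q + s * x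
adjoin-modulus {M} {suc x'} w₀ q M⊥x 1≤M 1≤x with inverse M⊥x 1≤M 1≤x
... | c , y , cM≡1+yx = c * Q , w₀ + y * Q , solution
  where
  open ≡-Reasoning
  Q : ℕ
  Q = q + x' * w₀
  regroup : ∀ w₀ c Q M → w₀ + c * Q * M ≡ w₀ + Q * (c * M)
  regroup = solve-∀
  collect : ∀ w₀ q x' y → w₀ + (q + x' * w₀) * (1 + y * suc x') ≡ q + (w₀ + y * (q + x' * w₀)) * suc x'
  collect = solve-∀
  solution : w₀ + c * Q * M ≡ q + (w₀ + y * Q) * suc x'
  solution = begin
    w₀ + c * Q * M              ≡⟨ regroup w₀ c Q M ⟩
    w₀ + Q * (c * M)            ≡⟨ cong (λ v → w₀ + Q * v) cM≡1+yx ⟩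
    w₀ + Q * (1 + y * suc x')   ≡⟨ collect w₀ q x' y ⟩
    q + (w₀ + y * Q) * suc x'   ∎

-- Induction on n: solve the
-- tail, then adjoin x₀ using M = ∏_{i>0} xᵢ, which is coprime to x₀.
crt : ∀ n (x q : Fin n → ℕ) → (∀ i → 1 ≤ x i) → (∀ i j → ¬ (i ≡ j) → Coprime (x i) (x j)) →
      Σ ℕ λ w → ∀ i → Σ ℕ λ s → w ≡ q i + s * x i
crt zero    x q x-pos x-cop = 0 , λ ()
crt (suc n) x q x-pos x-cop = w₀ + k * M , solves
  where
  tail : Σ ℕ λ w → ∀ i → Σ ℕ λ s → w ≡ q (Fin.suc i) + s * x (Fin.suc i)
  tail = crt n (x ∘ Fin.suc) (q ∘ Fin.suc) (x-pos ∘ Fin.suc)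
           (λ i j i≢j → x-cop (Fin.suc i) (Fin.suc j) (i≢j ∘ Fin-suc-injective))
  w₀ : ℕ
  w₀ = proj₁ tail
  M : ℕ
  M = product (tabulate (x ∘ Fin.suc))
  M⊥x₀ : Coprime M (x Fin.zero)
  M⊥x₀ = coprime-sym (coprime-product _ (tabulate⁺ λ i → x-cop Fin.zero (Fin.suc i) λ ()))
  1≤M : 1 ≤ M
  1≤M = >-nonZero⁻¹ M {{product≢0 (tabulate⁺ λ i → >-nonZero (x-pos (Fin.suc i)))}}
  step : Σ ℕ λ k → Σ ℕ λ s → w₀ + k * M ≡ q Fin.zero + s * x Fin.zero
  step = adjoin-modulus w₀ (q Fin.zero) M⊥x₀ 1≤M (x-pos Fin.zero)
  k : ℕ
  k = proj₁ step
  -- w₀ solves the tail congruences and k·M vanishes modulo each tail modulus.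
  solves : ∀ i → Σ ℕ λ s → w₀ + k * M ≡ q i + s * x i
  solves Fin.zero = proj₂ step
  solves (Fin.suc i) with proj₂ tail i | ∈⇒∣product (∈-tabulate⁺ {f = x ∘ Fin.suc} i)
  ... | s' , w₀≡ | divides d M≡dx = s' + k * d , (begin
    w₀ + k * M                             ≡⟨ cong₂ (λ a b → a + k * b) w₀≡ M≡dx ⟩
    q (Fin.suc i) + s' * xᵢ + k * (d * xᵢ) ≡⟨ collect (q (Fin.suc i)) s' xᵢ d k ⟩
    q (Fin.suc i) + (s' + k * d) * xᵢ      ∎)
    where
    open ≡-Reasoning
    xᵢ : ℕ
    xᵢ = x (Fin.suc i)
    collect : ∀ q s' x d k → q + s' * x + k * (d * x) ≡ q + (s' + k * d) * x
    collect = solve-∀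

cofactor-pos : ∀ {q u P} → 1 ≤ P → P ≡ q * u → 1 ≤ q
cofactor-pos {zero}  () refl
cofactor-pos {suc q} _  _ = s≤s z≤n

lift-solution : ∀ {w a P} Q x s R q u → w ≡ Q + x + s * x → a ≡ R + Q * P → P ≡ q * u →
                w * P + R ≡ a + suc s * q * x * u
lift-solution Q x s R q u refl refl refl = identity Q x s R q u
  where
  identity : ∀ Q x s R q u → (Q + x + s * x) * (q * u) + R ≡ R + Q * (q * u) + suc s * q * x * u
  identity = solve-∀

-- For any P ≥ 1 divisible by every uᵢ: z = w·P with w from the CRT for the targets
-- ⌊aᵢ/P⌋ + xᵢ, rᵢ = aᵢ mod P < P and tᵢ = (1 + sᵢ)·(P / uᵢ).  (n + 1 ≥ 1 moduli make
-- w ≥ x₀ ≥ 1, hence z ≥ 1.)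
represent : ∀ n P → 1 ≤ P → (a u x : Fin (suc n) → ℕ) → (∀ i → u i ∣ P) →
            (∀ i → 1 ≤ x i) → (∀ i j → ¬ (i ≡ j) → Coprime (x i) (x j)) →
            Σ ℕ λ z → Σ (Fin (suc n) → ℕ) λ r → Σ (Fin (suc n) → ℕ) λ t →
            (z ≥ 1) × ((i : Fin (suc n)) → (r i < P) × (t i ≥ 1) × (z + r i ≡ a i + t i * x i * u i))
represent n P 1≤P a u x u∣P x-pos x-cop =
  w * P , (λ i → a i % P) , t , *-mono-≤ 1≤w 1≤P , holds
  where
  instance
    P≢0 : NonZero P
    P≢0 = >-nonZero 1≤P
  solution : Σ ℕ λ w → ∀ i → Σ ℕ λ s → w ≡ a i / P + x i + s * x i
  solution = crt (suc n) x (λ i → a i / P + x i) x-pos x-cop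
  w : ℕ
  w = proj₁ solution
  s : Fin (suc n) → ℕ
  s i = proj₁ (proj₂ solution i)
  w≡ : ∀ i → w ≡ a i / P + x i + s i * x i
  w≡ i = proj₂ (proj₂ solution i)
  cofactor : Fin (suc n) → ℕ
  cofactor i = _∣_.quotient (u∣P i)
  cofactor-eq : ∀ i → P ≡ cofactor i * u i
  cofactor-eq i = _∣_.equality (u∣P i)
  t : Fin (suc n) → ℕ
  t i = suc (s i) * cofactor i
  1≤w : 1 ≤ w
  1≤w = begin
    1                                                     ≤⟨ x-pos Fin.zero ⟩
    x Fin.zero                                            ≤⟨ m≤n+m _ (a Fin.zero / P) ⟩
    a Fin.zero / P + x Fin.zero                           ≤⟨ m≤m+n _ (s Fin.zero * x Fin.zero) ⟩
    a Fin.zero / P + x Fin.zero + s Fin.zero * x Fin.zero ≡⟨ w≡ Fin.zero ⟨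
    w                                                     ∎
    where open ≤-Reasoning
  holds : ∀ i → (a i % P < P) × (t i ≥ 1) × (w * P + a i % P ≡ a i + t i * x i * u i)
  holds i = m%n<n (a i) P
          , *-mono-≤ (s≤s (z≤n {s i})) (cofactor-pos 1≤P (cofactor-eq i))
          , lift-solution (a i / P) (x i) (s i) (a i % P) (cofactor i) (u i)
              (w≡ i) (m≡m%n+[m/n]*n (a i) P) (cofactor-eq i)

maxT : ℕ → ℕ
maxT l = product (map (λ p → p ^ r p l) (primesUpTo l))

primesUpTo-spec : ∀ l → All (λ p → Prime p × p ≤ 2 * l + 1) (primesUpTo l)
primesUpTo-spec l = All.zip (all-filter prime? (range2 l) , filter⁺ prime? (applyUpTo⁺₁ (2 +_) (2 * l) in-range))
  where
  in-range : ∀ {i} → i < 2 * l → 2 + i ≤ 2 * l + 1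
  in-range {i} i<2l = subst (2 + i ≤_) (+-comm 1 (2 * l)) (s≤s i<2l)

length-primesUpTo : ∀ l → length (primesUpTo l) ≤ 2 * l + 1
length-primesUpTo l = begin
  length (primesUpTo l) ≤⟨ length-filter prime? (range2 l) ⟩
  length (range2 l)     ≡⟨ length-applyUpTo (2 +_) (2 * l) ⟩
  2 * l                 ≤⟨ m≤m+n (2 * l) 1 ⟩
  2 * l + 1             ∎
  where open ≤-Reasoning

maxT-pos : ∀ l → 1 ≤ maxT l
maxT-pos l = >-nonZero⁻¹ (maxT l) {{product≢0 (map⁺ (All.map power≢0 (primesUpTo-spec l)))}}
  where
  power≢0 : ∀ {p} → Prime p × p ≤ 2 * l + 1 → NonZero (p ^ r p l)
  power≢0 {p} (p-prime , _) = m^n≢0 p (r p l) {{prime⇒nonZero p-prime}}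

^-monoʳ-∣ : ∀ p {e f} → e ≤ f → p ^ e ∣ p ^ f
^-monoʳ-∣ p {e} {f} e≤f = divides (p ^ (f ∸ e)) (begin
  p ^ f               ≡⟨ cong (p ^_) (m∸n+n≡m e≤f) ⟨
  p ^ (f ∸ e + e)     ≡⟨ ^-distribˡ-+-* p (f ∸ e) e ⟩
  p ^ (f ∸ e) * p ^ e ∎)
  where open ≡-Reasoning

product-powers-∣ : ∀ (e f : ℕ → ℕ) ps → All (λ p → e p ≤ f p) ps →
                   product (map (λ p → p ^ e p) ps) ∣ product (map (λ p → p ^ f p) ps)
product-powers-∣ e f []       []           = divides 1 refl
product-powers-∣ e f (p ∷ ps) (e≤f ∷ es≤fs) = *-pres-∣ (^-monoʳ-∣ p e≤f) (product-powers-∣ e f ps es≤fs)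

InT⇒∣maxT : ∀ {l u} → InT l u → u ∣ maxT l
InT⇒∣maxT {l} (e , e≤r , refl) =
  product-powers-∣ e (λ p → r p l) (primesUpTo l)
    (All.map (λ (p-prime , p≤) → e≤r _ p-prime p≤) (primesUpTo-spec l))

-- r(p,l) is admissible: p^rUpTo p m k ≤ m whenever m ≥ 1 (the search falls back to t = 0).
rUpTo-bound : ∀ p m k → 1 ≤ m → p ^ rUpTo p m k ≤ m
rUpTo-bound p m zero    1≤m = 1≤m
rUpTo-bound p m (suc k) 1≤m with p ^ suc k ≤? m
... | yes p^k≤m = p^k≤m
... | no  _     = rUpTo-bound p m k 1≤m

product≤^length : ∀ {m} (g : ℕ → ℕ) ps → All (λ p → g p ≤ m) ps → product (map g ps) ≤ m ^ length ps
product≤^length g []       []           = ≤-refl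
product≤^length g (p ∷ ps) (gp≤m ∷ gps≤m) = *-mono-≤ gp≤m (product≤^length g ps gps≤m)

-- maxT l ≤ C(l): at most 2l+1 factors, each at most 2l+1.
maxT≤C : ∀ l → maxT l ≤ C l
maxT≤C l = begin
  maxT l                                ≤⟨ product≤^length _ _ (All.map (λ _ → factor≤m) (primesUpTo-spec l)) ⟩
  (2 * l + 1) ^ length (primesUpTo l)   ≤⟨ ^-monoʳ-≤ (2 * l + 1) {{>-nonZero 1≤m}} (length-primesUpTo l) ⟩
  C l                                   ∎
  where
  open ≤-Reasoning
  1≤m : 1 ≤ 2 * l + 1
  1≤m = m≤n+m 1 (2 * l)
  factor≤m : ∀ {p} → p ^ r p l ≤ 2 * l + 1
  factor≤m {p} = rUpTo-bound p (2 * l + 1) (2 * l + 1) 1≤m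

lemma3p7 : (l n : ℕ) → l ≥ 1 → n ≥ 1 →
    (a : Fin n → ℕ) → (u : Fin n → ℕ) → ((i : Fin n) → InT l (u i)) →
    (x : Fin n → ℕ) → ((i : Fin n) → x i ≥ 1) →
    ((i j : Fin n) → ¬ (i ≡ j) → Coprime (x i) (x j)) →
    Σ ℕ λ z → Σ (Fin n → ℕ) λ r → Σ (Fin n → ℕ) λ t →
    (z ≥ 1) ×
    ((i : Fin n) → (r i ≤ C l) × (t i ≥ 1) × (z + r i ≡ a i + t i * x i * u i))
lemma3p7 l (suc n) _ _ a u u∈T x x-pos x-cop
  with represent n (maxT l) (maxT-pos l) a u x (λ i → InT⇒∣maxT {l} (u∈T i)) x-pos x-cop
... | z , res , t , z≥1 , solves = z , res , t , z≥1 , bounded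
  where
  bounded : ∀ i → (res i ≤ C l) × (t i ≥ 1) × (z + res i ≡ a i + t i * x i * u i)
  bounded i with solves i
  ... | res<maxT , t≥1 , eq = ≤-trans (<⇒≤ res<maxT) (maxT≤C l) , t≥1 , eq
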